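{- Let $\mathcal{M}^{<>}$ be the set of Dyck paths whose sequence of peak heights (read left to right) is strictly unimodal. Then $$\sum_{D\in\mathcal{M}^{<>}}z^{|D|}=\sum_{a\ge0}z^a\big([a]_z!\big)^2,$$ where $|D|$ is the semilength, $[i]_z=1+z+\dots+z^{i-1}$, $[a]_z!=[a]_z[a-1]_z\cdots[1]_z$, and $[0]_z!=1$.
   Context: A Dyck path of semilength $n$ is a lattice path with steps $\mathbf{u}=(1,1)$ and $\mathbf{d}=(1,-1)$ from $(0,0)$ to $(2n,0)$ never going below the $x$-axis. A peak is an occurrence of consecutive steps $\mathbf{ud}$; its height is the $y$-coordinate of its highest vertex. A sequence $a_1,\dots,a_k$ is strictly unimodal if there is $j$ with $1\le j\le k$ and $a_1<\dots<a_j>a_{j+1}>\dots>a_k$; the empty path (no peaks) is included. -}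

module Defs where

open import Data.Nat using (ℕ; zero; suc; _+_; _*_; _∸_; _<ᵇ_)
open import Data.Bool using (Bool; true; false; _∧_; _∨_; not)
open import Data.List using (List; []; _∷_; _++_; length; map; replicate; foldr; take; drop; concatMap; filterᵇ; upTo)
open import Data.Bool.ListAction using (any)

-- Steps of a lattice path: u = (1,1), d = (1,-1).
data Step : Set where
  u d : Step

Path : Set
Path = List Step

dyckFrom : ℕ → Path → Bool
dyckFrom zero    []      = true
dyckFrom (suc _) []      = false
dyckFrom h       (u ∷ s) = dyckFrom (suc h) s
dyckFrom zero    (d ∷ s) = false
dyckFrom (suc h) (d ∷ s) = dyckFrom h s

isDyck : Path → Bool
isDyck = dyckFrom 0

peaksFrom : ℕ → Path → List ℕ
peaksFrom h []            = []
peaksFrom h (u ∷ d ∷ s)   = suc h ∷ peaksFrom (suc h) (d ∷ s)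
peaksFrom h (u ∷ s)       = peaksFrom (suc h) s
peaksFrom h (d ∷ s)       = peaksFrom (h ∸ 1) s

peaks : Path → List ℕ
peaks = peaksFrom 0

incr : List ℕ → Bool
incr []           = true
incr (x ∷ [])     = true
incr (x ∷ y ∷ l)  = (x <ᵇ y) ∧ incr (y ∷ l)

decr : List ℕ → Bool
decr []           = true
decr (x ∷ [])     = true
decr (x ∷ y ∷ l)  = (y <ᵇ x) ∧ decr (y ∷ l)

-- a_1..a_k strictly unimodal: k = 0, or there is j with 1 ≤ j ≤ k,
-- a_1 < ... < a_j (= incr (take j a)) and a_j > ... > a_k (= decr (drop (j-1) a)).
strictlyUnimodal : List ℕ → Bool
strictlyUnimodal [] = true
strictlyUnimodal a  =
  any (λ i → incr (take (suc i) a) ∧ decr (drop i a)) (upTo (length a))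

words : ℕ → List Path
words zero    = [] ∷ []
words (suc k) = concatMap (λ w → (u ∷ w) ∷ (d ∷ w) ∷ []) (words k)

-- |{ D ∈ M^{<>} : |D| = n }|  (Dyck paths of semilength n, length 2n)
countM : ℕ → ℕ
countM n = length (filterᵇ (λ p → isDyck p ∧ strictlyUnimodal (peaks p)) (words (2 * n)))

-- Polynomials in z with ℕ coefficients, as coefficient lists (constant term first).
Poly : Set
Poly = List ℕ

_⊕_ : Poly → Poly → Poly
[]      ⊕ q       = q
p       ⊕ []      = p
(a ∷ p) ⊕ (b ∷ q) = (a + b) ∷ (p ⊕ q)

_⊗_ : Poly → Poly → Poly
[]      ⊗ q = []
(a ∷ p) ⊗ q = map (a *_) q ⊕ (0 ∷ (p ⊗ q))

coeff : Poly → ℕ → ℕ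
coeff []      _       = 0
coeff (a ∷ p) zero    = a
coeff (a ∷ p) (suc n) = coeff p n

shift : ℕ → Poly → Poly
shift a p = replicate a 0 ++ p

qint : ℕ → Poly
qint i = replicate i 1

qfact : ℕ → Poly
qfact zero    = 1 ∷ []
qfact (suc a) = qint (suc a) ⊗ qfact a

term : ℕ → Poly
term a = shift a (qfact a ⊗ qfact a)

-- coefficient of z^n in Σ_{a ≥ 0} z^a ([a]_z!)^2 ; summands with a > n are
-- multiples of z^{n+1} and do not contribute, so the sum over a ≤ n suffices.
rhsCoeff : ℕ → ℕ
rhsCoeff n = coeff (foldr _⊕_ [] (map term (upTo (suc n)))) n

module Submission where

-- A strictly unimodal Dyck path rises through increasing peaks to its maximal peak and then falls
-- through decreasing peaks. Paths are counted by length with series in x, so z = x². A descent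
-- from height q to the ground whose peaks decrease strictly and stay at most q has series
-- x^q [q+1]_z!: raising the admissible height of the first peak by one adds the descents whose
-- first peak is exactly at the new height, and these contribute one new factor [·]_z. The same
-- device applied to a bound M on the rising peaks shows that raising M to M + 1 adds exactly the
-- paths with maximal peak M + 1, whose series is x^(M+2) [M+1]_z! times that of a descent from
-- height M, that is z^(M+1) ([M+1]_z!)².

open import Defs
open import Data.Bool using (Bool; true; false; _∧_; _∨_; if_then_else_)
open import Data.Bool.ListAction using (any; or)
open import Data.Bool.Properties using (∧-zeroʳ; ∨-identityʳ)
open import Data.List using (List; []; _∷_; length; map; foldr; filterᵇ; upTo; applyUpTo; take; drop; concatMap)
open import Data.List.Properties using (map-applyUpTo; map-upTo; applyUpTo-∷ʳ)
open import Data.Nat using (ℕ; zero; suc; _+_; _*_; _<ᵇ_; _≤_; _<_; z≤n; s≤s; s≤s⁻¹)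
open import Data.Nat.ListAction using (sum)
open import Data.Nat.ListAction.Properties using (sum-++)
open import Data.Nat.Properties
open import Algebra.Properties.CommutativeSemigroup +-commutativeSemigroup using (interchange; xy∙z≈xz∙y)
open import Algebra.Properties.CommutativeSemigroup *-commutativeSemigroup using () renaming (x∙yz≈y∙xz to *-left-comm)
open import Function using (_∘_)
open import Relation.Binary.Bundles using (Setoid)
open import Relation.Binary.PropositionalEquality
import Relation.Binary.Reasoning.Setoid as SetoidReasoning
open Setoid (ℕ →-setoid ℕ) using () renaming (sym to ≗-sym; trans to ≗-trans)

<ᵇ-true : ∀ {m n} → m < n → (m <ᵇ n) ≡ true
<ᵇ-true {zero}  (s≤s _)           = refl
<ᵇ-true {suc m} (s≤s m<n@(s≤s _)) = <ᵇ-true m<n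

<ᵇ-false : ∀ {m n} → n ≤ m → (m <ᵇ n) ≡ false
<ᵇ-false {m}     {zero}  z≤n       = refl
<ᵇ-false {suc m} {suc n} (s≤s n≤m) = <ᵇ-false n≤m

<ᵇ≡true⇒< : ∀ {m n} → (m <ᵇ n) ≡ true → m < n
<ᵇ≡true⇒< {zero}  {suc n} _   = s≤s z≤n
<ᵇ≡true⇒< {suc m} {suc n} m<n = s≤s (<ᵇ≡true⇒< m<n)

if-true : ∀ {A : Set} {b} {x y : A} → b ≡ true → (if b then x else y) ≡ x
if-true refl = refl

if-false : ∀ {A : Set} {b} {x y : A} → b ≡ false → (if b then x else y) ≡ y
if-false refl = refl

sum-applyUpTo-suc : ∀ (f : ℕ → ℕ) n → sum (applyUpTo f (suc n)) ≡ sum (applyUpTo f n) + f n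
sum-applyUpTo-suc f n =
  trans (cong sum (sym (applyUpTo-∷ʳ f n)))
        (trans (sum-++ (applyUpTo f n) (f n ∷ [])) (cong (sum (applyUpTo f n) +_) (+-identityʳ (f n))))

sum-applyUpTo-vanishing : ∀ (f : ℕ → ℕ) n j → (∀ i → n ≤ i → f i ≡ 0) →
  sum (applyUpTo f (n + j)) ≡ sum (applyUpTo f n)
sum-applyUpTo-vanishing f n zero    f≡0 = cong (sum ∘ applyUpTo f) (+-identityʳ n)
sum-applyUpTo-vanishing f n (suc j) f≡0 = begin
  sum (applyUpTo f (n + suc j))          ≡⟨ cong (sum ∘ applyUpTo f) (+-suc n j) ⟩
  sum (applyUpTo f (suc (n + j)))        ≡⟨ sum-applyUpTo-suc f (n + j) ⟩
  sum (applyUpTo f (n + j)) + f (n + j)  ≡⟨ cong₂ _+_ (sum-applyUpTo-vanishing f n j f≡0) (f≡0 (n + j) (m≤m+n n j)) ⟩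
  sum (applyUpTo f n) + 0                ≡⟨ +-identityʳ _ ⟩
  sum (applyUpTo f n)                    ∎
  where open ≡-Reasoning

-- Coefficients are indexed by path length; a polynomial in z acts through z = x².
Series : Set
Series = ℕ → ℕ

infixl 6 _⊞_
_⊞_ : Series → Series → Series
(f ⊞ g) k = f k + g k

infixl 7 _·_
_·_ : ℕ → Series → Series
(c · g) k = c * g k

𝟘 δ : Series
𝟘 _ = 0
δ zero    = 1
δ (suc _) = 0

mulX : ℕ → Series → Series
mulX zero    g k       = g k
mulX (suc e) g zero    = 0
mulX (suc e) g (suc k) = mulX e g k

mulX-cong : ∀ e {f g} → f ≗ g → mulX e f ≗ mulX e g
mulX-cong zero    f≗g k       = f≗g k
mulX-cong (suc e) f≗g zero    = refl
mulX-cong (suc e) f≗g (suc k) = mulX-cong e f≗g k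

mulX-𝟘 : ∀ e → mulX e 𝟘 ≗ 𝟘
mulX-𝟘 zero    k       = refl
mulX-𝟘 (suc e) zero    = refl
mulX-𝟘 (suc e) (suc k) = mulX-𝟘 e k

mulX-⊞ : ∀ e f g → mulX e (f ⊞ g) ≗ mulX e f ⊞ mulX e g
mulX-⊞ zero    f g k       = refl
mulX-⊞ (suc e) f g zero    = refl
mulX-⊞ (suc e) f g (suc k) = mulX-⊞ e f g k

mulX-· : ∀ e c g → mulX e (c · g) ≗ c · mulX e g
mulX-· zero    c g k       = refl
mulX-· (suc e) c g zero    = sym (*-zeroʳ c)
mulX-· (suc e) c g (suc k) = mulX-· e c g k

mulX-+ : ∀ a b g → mulX (a + b) g ≗ mulX a (mulX b g)
mulX-+ zero    b g k       = refl
mulX-+ (suc a) b g zero    = refl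
mulX-+ (suc a) b g (suc k) = mulX-+ a b g k

mulX-comm : ∀ a b g → mulX a (mulX b g) ≗ mulX b (mulX a g)
mulX-comm a b g k = begin
  mulX a (mulX b g) k ≡⟨ mulX-+ a b g k ⟨
  mulX (a + b) g k    ≡⟨ cong (λ e → mulX e g k) (+-comm a b) ⟩
  mulX (b + a) g k    ≡⟨ mulX-+ b a g k ⟩
  mulX b (mulX a g) k ∎
  where open ≡-Reasoning

mulX-low : ∀ e g {k} → k < e → mulX e g k ≡ 0
mulX-low (suc e) g {zero}  _         = refl
mulX-low (suc e) g {suc k} (s≤s k<e) = mulX-low e g k<e

mulZ : Poly → Series → Series
mulZ []      g k = 0
mulZ (c ∷ q) g k = c * g k + mulX 2 (mulZ q g) k

mulZ-cong : ∀ q {f g} → f ≗ g → mulZ q f ≗ mulZ q g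
mulZ-cong []      f≗g k = refl
mulZ-cong (c ∷ q) f≗g k = cong₂ _+_ (cong (c *_) (f≗g k)) (mulX-cong 2 (mulZ-cong q f≗g) k)

mulZ-𝟘 : ∀ q → mulZ q 𝟘 ≗ 𝟘
mulZ-𝟘 []      k = refl
mulZ-𝟘 (c ∷ q) k = cong₂ _+_ (*-zeroʳ c) (≗-trans (mulX-cong 2 (mulZ-𝟘 q)) (mulX-𝟘 2) k)

mulZ-⊞ : ∀ q f g → mulZ q (f ⊞ g) ≗ mulZ q f ⊞ mulZ q g
mulZ-⊞ []      f g k = refl
mulZ-⊞ (c ∷ q) f g k = begin
  c * (f k + g k) + mulX 2 (mulZ q (f ⊞ g)) k
    ≡⟨ cong₂ _+_ (*-distribˡ-+ c (f k) (g k)) (≗-trans (mulX-cong 2 (mulZ-⊞ q f g)) (mulX-⊞ 2 _ _) k) ⟩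
  (c * f k + c * g k) + (mulX 2 (mulZ q f) k + mulX 2 (mulZ q g) k)
    ≡⟨ interchange (c * f k) (c * g k) (mulX 2 (mulZ q f) k) _ ⟩
  mulZ (c ∷ q) f k + mulZ (c ∷ q) g k ∎
  where open ≡-Reasoning

mulZ-· : ∀ q c g → mulZ q (c · g) ≗ c · mulZ q g
mulZ-· []      c g k = sym (*-zeroʳ c)
mulZ-· (a ∷ q) c g k = begin
  a * (c * g k) + mulX 2 (mulZ q (c · g)) k
    ≡⟨ cong₂ _+_ (*-left-comm a c (g k)) (≗-trans (mulX-cong 2 (mulZ-· q c g)) (mulX-· 2 c _) k) ⟩
  c * (a * g k) + c * mulX 2 (mulZ q g) k
    ≡⟨ *-distribˡ-+ c _ _ ⟨
  c * mulZ (a ∷ q) g k ∎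
  where open ≡-Reasoning

mulZ-mulX : ∀ q e g → mulZ q (mulX e g) ≗ mulX e (mulZ q g)
mulZ-mulX []      e g k = sym (mulX-𝟘 e k)
mulZ-mulX (c ∷ q) e g k = begin
  c * mulX e g k + mulX 2 (mulZ q (mulX e g)) k
    ≡⟨ cong₂ _+_ (mulX-· e c g k) (≗-trans (mulX-comm e 2 _) (mulX-cong 2 (≗-sym (mulZ-mulX q e g))) k) ⟨
  mulX e (c · g) k + mulX e (mulX 2 (mulZ q g)) k
    ≡⟨ mulX-⊞ e (c · g) (mulX 2 (mulZ q g)) k ⟨
  mulX e (mulZ (c ∷ q) g) k ∎
  where open ≡-Reasoning

mulZ-comm : ∀ p q g → mulZ p (mulZ q g) ≗ mulZ q (mulZ p g)
mulZ-comm []      q g k = sym (mulZ-𝟘 q k)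
mulZ-comm (c ∷ p) q g k = begin
  c * mulZ q g k + mulX 2 (mulZ p (mulZ q g)) k
    ≡⟨ cong₂ _+_ (mulZ-· q c g k) (≗-trans (mulZ-mulX q 2 _) (mulX-cong 2 (≗-sym (mulZ-comm p q g))) k) ⟨
  mulZ q (c · g) k + mulZ q (mulX 2 (mulZ p g)) k
    ≡⟨ mulZ-⊞ q (c · g) (mulX 2 (mulZ p g)) k ⟨
  mulZ q (mulZ (c ∷ p) g) k ∎
  where open ≡-Reasoning

mulZ-⊕ : ∀ p q g → mulZ (p ⊕ q) g ≗ mulZ p g ⊞ mulZ q g
mulZ-⊕ []      q       g k = refl
mulZ-⊕ (a ∷ p) []      g k = sym (+-identityʳ _)
mulZ-⊕ (a ∷ p) (b ∷ q) g k = begin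
  (a + b) * g k + mulX 2 (mulZ (p ⊕ q) g) k
    ≡⟨ cong₂ _+_ (*-distribʳ-+ (g k) a b) (≗-trans (mulX-cong 2 (mulZ-⊕ p q g)) (mulX-⊞ 2 _ _) k) ⟩
  (a * g k + b * g k) + (mulX 2 (mulZ p g) k + mulX 2 (mulZ q g) k)
    ≡⟨ interchange (a * g k) (b * g k) (mulX 2 (mulZ p g) k) _ ⟩
  mulZ (a ∷ p) g k + mulZ (b ∷ q) g k ∎
  where open ≡-Reasoning

mulZ-foldr-⊕ : ∀ (f : ℕ → Poly) g k ns → mulZ (foldr _⊕_ [] (map f ns)) g k ≡ sum (map (λ a → mulZ (f a) g k) ns)
mulZ-foldr-⊕ f g k []       = refl
mulZ-foldr-⊕ f g k (n ∷ ns) = trans (mulZ-⊕ (f n) _ g k) (cong (mulZ (f n) g k +_) (mulZ-foldr-⊕ f g k ns))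

mulZ-map-* : ∀ a q g → mulZ (map (a *_) q) g ≗ a · mulZ q g
mulZ-map-* a []      g k = sym (*-zeroʳ a)
mulZ-map-* a (b ∷ q) g k = begin
  a * b * g k + mulX 2 (mulZ (map (a *_) q) g) k
    ≡⟨ cong₂ _+_ (*-assoc a b (g k)) (≗-trans (mulX-cong 2 (mulZ-map-* a q g)) (mulX-· 2 a _) k) ⟩
  a * (b * g k) + a * mulX 2 (mulZ q g) k
    ≡⟨ *-distribˡ-+ a _ _ ⟨
  a * mulZ (b ∷ q) g k ∎
  where open ≡-Reasoning

mulZ-⊗ : ∀ p q g → mulZ (p ⊗ q) g ≗ mulZ p (mulZ q g)
mulZ-⊗ []      q g k = refl
mulZ-⊗ (a ∷ p) q g k =
  trans (mulZ-⊕ (map (a *_) q) (0 ∷ (p ⊗ q)) g k)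
        (cong₂ _+_ (mulZ-map-* a q g k) (mulX-cong 2 (mulZ-⊗ p q g) k))

mulZ-shift : ∀ a p g → mulZ (shift a p) g ≗ mulX (2 * a) (mulZ p g)
mulZ-shift zero    p g k = refl
mulZ-shift (suc a) p g k = begin
  mulX 2 (mulZ (shift a p) g) k     ≡⟨ mulX-cong 2 (mulZ-shift a p g) k ⟩
  mulX 2 (mulX (2 * a) (mulZ p g)) k ≡⟨ mulX-+ 2 (2 * a) _ k ⟨
  mulX (2 + 2 * a) (mulZ p g) k      ≡⟨ cong (λ e → mulX e (mulZ p g) k) (*-suc 2 a) ⟨
  mulX (2 * suc a) (mulZ p g) k      ∎
  where open ≡-Reasoning

mulZ-one : ∀ g → mulZ (1 ∷ []) g ≗ g
mulZ-one g k = trans (cong₂ _+_ (*-identityˡ (g k)) (mulX-𝟘 2 k)) (+-identityʳ (g k))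

coeff-mulZ-δ : ∀ p n → coeff p n ≡ mulZ p δ (2 * n)
coeff-mulZ-δ []      n       = refl
coeff-mulZ-δ (c ∷ p) zero    = sym (trans (+-identityʳ (c * 1)) (*-identityʳ c))
coeff-mulZ-δ (c ∷ p) (suc n) = begin
  coeff p n                       ≡⟨ coeff-mulZ-δ p n ⟩
  mulZ p δ (2 * n)                ≡⟨ cong (_+ mulZ p δ (2 * n)) (*-zeroʳ c) ⟨
  mulZ (c ∷ p) δ (2 + 2 * n)      ≡⟨ cong (mulZ (c ∷ p) δ) (*-suc 2 n) ⟨
  mulZ (c ∷ p) δ (2 * suc n)      ∎
  where open ≡-Reasoning

qI : ℕ → Series → Series
qI t = mulZ (qint t)

qI-suc : ∀ t g → qI (suc t) g ≗ g ⊞ mulX 2 (qI t g)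
qI-suc t g k = cong (_+ mulX 2 (qI t g) k) (*-identityˡ (g k))

mulX-qI-suc : ∀ e t g → mulX e g ⊞ mulX (2 + e) (qI t g) ≗ mulX e (qI (suc t) g)
mulX-qI-suc e t g = begin
  mulX e g ⊞ mulX (2 + e) (qI t g)        ≈⟨ (λ k → cong (mulX e g k +_) (≗-trans (mulX-+ 2 e _) (mulX-comm 2 e _) k)) ⟩
  mulX e g ⊞ mulX e (mulX 2 (qI t g))     ≈⟨ mulX-⊞ e g _ ⟨
  mulX e (g ⊞ mulX 2 (qI t g))            ≈⟨ mulX-cong e (qI-suc t g) ⟨
  mulX e (qI (suc t) g)                   ∎
  where open SetoidReasoning (ℕ →-setoid ℕ)

+-mulX-qI-suc : ∀ a b e t g k →
  (a + mulX e g k) + (b + mulX (2 + e) (qI t g) k) ≡ (a + b) + mulX e (qI (suc t) g) k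
+-mulX-qI-suc a b e t g k =
  trans (interchange a (mulX e g k) b _) (cong (a + b +_) (mulX-qI-suc e t g k))

qProd : ℕ → ℕ → Series → Series
qProd a zero    g = g
qProd a (suc l) g = qI (suc a) (qProd (suc a) l g)

qProd-cong : ∀ a l {f g} → f ≗ g → qProd a l f ≗ qProd a l g
qProd-cong a zero    f≗g = f≗g
qProd-cong a (suc l) f≗g = mulZ-cong (qint (suc a)) (qProd-cong (suc a) l f≗g)

qProd-snoc : ∀ a l g → qProd a (suc l) g ≗ qProd a l (qI (suc (a + l)) g)
qProd-snoc a zero    g k = cong (λ t → qI (suc t) g k) (sym (+-identityʳ a))
qProd-snoc a (suc l) g =
  mulZ-cong (qint (suc a))
    (≗-trans (qProd-snoc (suc a) l g) (qProd-cong (suc a) l (λ k → cong (λ t → qI (suc t) g k) (sym (+-suc a l)))))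

qProd-qfact : ∀ n g → qProd 0 n g ≗ mulZ (qfact n) g
qProd-qfact zero    g = ≗-sym (mulZ-one g)
qProd-qfact (suc n) g = begin
  qProd 0 (suc n) g                         ≈⟨ qProd-snoc 0 n g ⟩
  qProd 0 n (qI (suc n) g)                  ≈⟨ qProd-qfact n _ ⟩
  mulZ (qfact n) (qI (suc n) g)             ≈⟨ mulZ-comm (qfact n) (qint (suc n)) g ⟩
  mulZ (qint (suc n)) (mulZ (qfact n) g)    ≈⟨ mulZ-⊗ (qint (suc n)) (qfact n) g ⟨
  mulZ (qfact (suc n)) g                    ∎
  where open SetoidReasoning (ℕ →-setoid ℕ)

countIn : (Path → Bool) → List Path → ℕ
countIn P ws = length (filterᵇ P ws)

count : (Path → Bool) → ℕ → ℕ
count P k = countIn P (words k)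

indicator : Bool → ℕ
indicator true  = 1
indicator false = 0

countIn-∷ : ∀ P w ws → countIn P (w ∷ ws) ≡ indicator (P w) + countIn P ws
countIn-∷ P w ws with P w
... | true  = refl
... | false = refl

count-cong : ∀ {P Q} → (∀ w → P w ≡ Q w) → ∀ k → count P k ≡ count Q k
count-cong {P} {Q} P≡Q k = go (words k)
  where
  go : ∀ ws → countIn P ws ≡ countIn Q ws
  go []       = refl
  go (w ∷ ws) = begin
    countIn P (w ∷ ws)              ≡⟨ countIn-∷ P w ws ⟩
    indicator (P w) + countIn P ws  ≡⟨ cong₂ _+_ (cong indicator (P≡Q w)) (go ws) ⟩
    indicator (Q w) + countIn Q ws  ≡⟨ countIn-∷ Q w ws ⟨
    countIn Q (w ∷ ws)              ∎
    where open ≡-Reasoning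

count-false : ∀ k → count (λ _ → false) k ≡ 0
count-false k = go (words k)
  where
  go : ∀ ws → countIn (λ _ → false) ws ≡ 0
  go []       = refl
  go (_ ∷ ws) = go ws

count-suc : ∀ P k → count P (suc k) ≡ count (P ∘ (u ∷_)) k + count (P ∘ (d ∷_)) k
count-suc P k = go (words k)
  where
  go : ∀ ws → countIn P (concatMap (λ w → (u ∷ w) ∷ (d ∷ w) ∷ []) ws)
            ≡ countIn (P ∘ (u ∷_)) ws + countIn (P ∘ (d ∷_)) ws
  go []       = refl
  go (w ∷ ws) = begin
    countIn P ((u ∷ w) ∷ (d ∷ w) ∷ rest)       ≡⟨ countIn-∷ P _ _ ⟩
    a + countIn P ((d ∷ w) ∷ rest)             ≡⟨ cong (a +_) (countIn-∷ P _ _) ⟩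
    a + (b + countIn P rest)                   ≡⟨ +-assoc a b _ ⟨
    (a + b) + countIn P rest                   ≡⟨ cong ((a + b) +_) (go ws) ⟩
    (a + b) + (countIn Pu ws + countIn Pd ws)  ≡⟨ interchange a b _ _ ⟩
    (a + countIn Pu ws) + (b + countIn Pd ws)  ≡⟨ cong₂ _+_ (countIn-∷ Pu w ws) (countIn-∷ Pd w ws) ⟨
    countIn Pu (w ∷ ws) + countIn Pd (w ∷ ws)  ∎
    where
    open ≡-Reasoning
    rest = concatMap (λ w → (u ∷ w) ∷ (d ∷ w) ∷ []) ws
    Pu = P ∘ (u ∷_)
    Pd = P ∘ (d ∷_)
    a = indicator (Pu w)
    b = indicator (Pd w)

count-∧-guard : ∀ (A B : Path → Bool) b k →
  count (λ w → A w ∧ (b ∧ B w)) k ≡ (if b then count (λ w → A w ∧ B w) k else 0)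
count-∧-guard A B true  k = refl
count-∧-guard A B false k = trans (count-cong (λ w → ∧-zeroʳ (A w)) k) (count-false k)

count-∧-if : ∀ (A B C : Path → Bool) b k →
  count (λ w → A w ∧ (if b then B w else C w)) k
    ≡ (if b then count (λ w → A w ∧ B w) k else count (λ w → A w ∧ C w) k)
count-∧-if A B C true  k = refl
count-∧-if A B C false k = refl

-- Strict unimodality

unimodalFrom : ℕ → List ℕ → Bool
unimodalFrom x []      = true
unimodalFrom x (y ∷ l) = if x <ᵇ y then unimodalFrom y l else decr (x ∷ y ∷ l)

any-upTo-suc : ∀ (f : ℕ → Bool) n → any f (upTo (suc n)) ≡ f 0 ∨ any (f ∘ suc) (upTo n)
any-upTo-suc f n =
  cong (λ bs → f 0 ∨ or bs) (trans (map-applyUpTo suc f n) (sym (map-upTo (f ∘ suc) n)))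

any-guard : ∀ b (f g : ℕ → Bool) ns → any (λ i → (b ∧ f i) ∧ g i) ns ≡ b ∧ any (λ i → f i ∧ g i) ns
any-guard true  f g ns       = refl
any-guard false f g []       = refl
any-guard false f g (_ ∷ ns) = any-guard false f g ns

strictlyUnimodal-∷∷ : ∀ x y l →
  strictlyUnimodal (x ∷ y ∷ l) ≡ decr (x ∷ y ∷ l) ∨ ((x <ᵇ y) ∧ strictlyUnimodal (y ∷ l))
strictlyUnimodal-∷∷ x y l =
  trans (any-upTo-suc (λ i → incr (take (suc i) (x ∷ y ∷ l)) ∧ decr (drop i (x ∷ y ∷ l))) (suc (length l)))
        (cong (decr (x ∷ y ∷ l) ∨_)
              (any-guard (x <ᵇ y) (λ i → incr (y ∷ take i l)) (λ i → decr (drop i (y ∷ l)))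
                         (upTo (suc (length l)))))

rise-or-fall : ∀ x y l b → decr (x ∷ y ∷ l) ∨ ((x <ᵇ y) ∧ b) ≡ (if x <ᵇ y then b else decr (x ∷ y ∷ l))
rise-or-fall x y l b with x <ᵇ y in x<y
... | true  rewrite <ᵇ-false {y} {x} (<⇒≤ (<ᵇ≡true⇒< x<y)) = refl
... | false = ∨-identityʳ _

strictlyUnimodal-∷ : ∀ x l → strictlyUnimodal (x ∷ l) ≡ unimodalFrom x l
strictlyUnimodal-∷ x []      = refl
strictlyUnimodal-∷ x (y ∷ l) = begin
  strictlyUnimodal (x ∷ y ∷ l)                            ≡⟨ strictlyUnimodal-∷∷ x y l ⟩
  decr (x ∷ y ∷ l) ∨ ((x <ᵇ y) ∧ strictlyUnimodal (y ∷ l)) ≡⟨ cong (λ b → decr (x ∷ y ∷ l) ∨ ((x <ᵇ y) ∧ b)) (strictlyUnimodal-∷ y l) ⟩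
  decr (x ∷ y ∷ l) ∨ ((x <ᵇ y) ∧ unimodalFrom y l)        ≡⟨ rise-or-fall x y l (unimodalFrom y l) ⟩
  unimodalFrom x (y ∷ l)                                  ∎
  where open ≡-Reasoning

-- Every peak is positive, so a virtual peak at height 0 may be put in front.
strictlyUnimodal-peaks : ∀ h w → strictlyUnimodal (peaksFrom h w) ≡ unimodalFrom 0 (peaksFrom h w)
strictlyUnimodal-peaks h []          = refl
strictlyUnimodal-peaks h (u ∷ d ∷ w) = strictlyUnimodal-∷ (suc h) (peaksFrom (suc h) (d ∷ w))
strictlyUnimodal-peaks h (u ∷ [])    = refl
strictlyUnimodal-peaks h (u ∷ u ∷ w) = strictlyUnimodal-peaks (suc h) (u ∷ w)
strictlyUnimodal-peaks h (d ∷ w)     = strictlyUnimodal-peaks _ w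

-- Completions of a prefix whose last peak had height p: from height h (for the ↑ variants, from
-- height suc h just after an up step) the word ends on the ground and continues the peak sequence
-- strictly decreasingly, resp. strictly unimodally.
descending descending↑ unimodal unimodal↑ : ℕ → ℕ → Path → Bool
descending  h p w = dyckFrom h w       ∧ decr (p ∷ peaksFrom h w)
descending↑ h p w = dyckFrom (suc h) w ∧ decr (p ∷ peaksFrom h (u ∷ w))
unimodal    h p w = dyckFrom h w       ∧ unimodalFrom p (peaksFrom h w)
unimodal↑   h p w = dyckFrom (suc h) w ∧ unimodalFrom p (peaksFrom h (u ∷ w))

-- k is the number of remaining steps; peaks of the rising phase are bounded by M.
mutual
  descents descents↑ : ℕ → ℕ → ℕ → ℕ
  descents zero    zero    p = 1
  descents zero    (suc h) p = 0
  descents (suc k) zero    p = descents↑ k zero p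
  descents (suc k) (suc h) p = descents↑ k (suc h) p + descents k h p

  descents↑ zero    h p = 0
  descents↑ (suc k) h p = descents↑ k (suc h) p + (if suc h <ᵇ p then descents k h (suc h) else 0)

mutual
  unimodals unimodals↑ : ℕ → ℕ → ℕ → ℕ → ℕ
  unimodals M zero    zero    p = 1
  unimodals M zero    (suc h) p = 0
  unimodals M (suc k) zero    p = unimodals↑ M k zero p
  unimodals M (suc k) (suc h) p = unimodals↑ M k (suc h) p + unimodals M k h p

  unimodals↑ M zero    h p = 0
  unimodals↑ M (suc k) h p = unimodals↑ M k (suc h) p +
    (if p <ᵇ suc h then (if h <ᵇ M then unimodals M k h (suc h) else 0)
                   else (if suc h <ᵇ p then descents k h (suc h) else 0))

mutual
  count-descending : ∀ k h p → count (descending h p) k ≡ descents k h p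
  count-descending zero    zero    p = refl
  count-descending zero    (suc h) p = refl
  count-descending (suc k) zero    p =
    trans (count-suc _ k) (trans (cong₂ _+_ (count-descending↑ k zero p) (count-false k)) (+-identityʳ _))
  count-descending (suc k) (suc h) p =
    trans (count-suc _ k) (cong₂ _+_ (count-descending↑ k (suc h) p) (count-descending k h p))

  count-descending↑ : ∀ k h p → count (descending↑ h p) k ≡ descents↑ k h p
  count-descending↑ zero    h p = refl
  count-descending↑ (suc k) h p =
    trans (count-suc _ k) (cong₂ _+_ (count-descending↑ k (suc h) p) (count-descending-peak k h p))

  count-descending-peak : ∀ k h p →
    count (descending↑ h p ∘ (d ∷_)) k ≡ (if suc h <ᵇ p then descents k h (suc h) else 0)
  count-descending-peak k h p =
    trans (count-∧-guard (dyckFrom h) (λ w → decr (suc h ∷ peaksFrom h w)) (suc h <ᵇ p) k)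
          (cong (λ n → if suc h <ᵇ p then n else 0) (count-descending k h (suc h)))

step-bound : ∀ {h k M} → suc h + suc k ≤ M → suc (suc h) + k ≤ M
step-bound {h} {k} {M} = subst (_≤ M) (cong suc (+-suc h k))

shrink-bound : ∀ {h k M} → suc h + suc k ≤ M → h + k ≤ M
shrink-bound {h} {k} = ≤-trans (+-mono-≤ (n≤1+n h) (n≤1+n k))

mutual
  count-unimodal : ∀ M k h p → h + k ≤ M → count (unimodal h p) k ≡ unimodals M k h p
  count-unimodal M zero    zero    p _     = refl
  count-unimodal M zero    (suc h) p _     = refl
  count-unimodal M (suc k) zero    p bound =
    trans (count-suc _ k) (trans (cong₂ _+_ (count-unimodal↑ M k zero p bound) (count-false k)) (+-identityʳ _))
  count-unimodal M (suc k) (suc h) p bound =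
    trans (count-suc _ k)
          (cong₂ _+_ (count-unimodal↑ M k (suc h) p (step-bound bound)) (count-unimodal M k h p (shrink-bound bound)))

  count-unimodal↑ : ∀ M k h p → suc h + k ≤ M → count (unimodal↑ h p) k ≡ unimodals↑ M k h p
  count-unimodal↑ M zero    h p _     = refl
  count-unimodal↑ M (suc k) h p bound =
    trans (count-suc _ k) (cong₂ _+_ (count-unimodal↑ M k (suc h) p (step-bound bound)) peak)
    where
    rising : count (unimodal h (suc h)) k ≡ (if h <ᵇ M then unimodals M k h (suc h) else 0)
    rising = trans (count-unimodal M k h (suc h) (shrink-bound bound))
                   (sym (if-true (<ᵇ-true (≤-trans (m≤m+n (suc h) (suc k)) bound))))

    peak : count (unimodal↑ h p ∘ (d ∷_)) k
         ≡ (if p <ᵇ suc h then (if h <ᵇ M then unimodals M k h (suc h) else 0)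
                          else (if suc h <ᵇ p then descents k h (suc h) else 0))
    peak = trans (count-∧-if (dyckFrom h) (λ w → unimodalFrom (suc h) (peaksFrom h w))
                             (λ w → decr (p ∷ suc h ∷ peaksFrom h w)) (p <ᵇ suc h) k)
                 (cong₂ (λ m n → if p <ᵇ suc h then m else n) rising (count-descending-peak k h p))

countM≡unimodals : ∀ n → countM n ≡ unimodals (2 * n) (2 * n) 0 0
countM≡unimodals n =
  trans (count-cong (λ w → cong (dyckFrom 0 w ∧_) (strictlyUnimodal-peaks 0 w)) (2 * n))
        (count-unimodal (2 * n) (2 * n) 0 0 ≤-refl)

-- Descents

descents↑-vanish : ∀ k h p → p ≤ suc h → descents↑ k h p ≡ 0
descents↑-vanish zero    h p _   = refl
descents↑-vanish (suc k) h p p≤ =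
  cong₂ _+_ (descents↑-vanish k (suc h) p (m≤n⇒m≤1+n p≤)) (if-false (<ᵇ-false p≤))

descents-ground : ∀ k p → p ≤ 1 → descents k 0 p ≡ δ k
descents-ground zero    p _  = refl
descents-ground (suc k) p p≤ = descents↑-vanish k 0 p p≤

descentSeries : ℕ → Series
descentSeries q k = descents k q (suc q)

descents↑-raise : ∀ k h e q → e + h ≡ q →
  descents↑ k h (2 + q) ≡ descents↑ k h (1 + q) + mulX (suc e) (descentSeries q) k
descents↑-raise zero    h e       q eq   = refl
descents↑-raise (suc k) h zero    .h refl = begin
  descents↑ k (suc h) (2 + h) + (if suc h <ᵇ 2 + h then X else 0)
    ≡⟨ cong₂ _+_ (descents↑-vanish k (suc h) (2 + h) ≤-refl) (if-true (<ᵇ-true {suc h} ≤-refl)) ⟩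
  X
    ≡⟨ cong₂ (λ a b → a + b + X) (descents↑-vanish k (suc h) (1 + h) (n≤1+n _))
                                  (if-false (<ᵇ-false {suc h} ≤-refl)) ⟨
  descents↑ k (suc h) (1 + h) + (if suc h <ᵇ 1 + h then X else 0) + X ∎
  where
  open ≡-Reasoning
  X = descents k h (suc h)
descents↑-raise (suc k) h (suc e) q eq = begin
  A₂ + (if suc h <ᵇ 2 + q then X else 0)
    ≡⟨ cong₂ _+_ (descents↑-raise k (suc h) e q (trans (+-suc e h) eq))
                 (if-true (<ᵇ-true (m≤n⇒m≤1+n (s≤s h<q)))) ⟩
  A₁ + S + X
    ≡⟨ xy∙z≈xz∙y A₁ S X ⟩
  A₁ + X + S
    ≡⟨ cong (λ n → A₁ + n + S) (if-true (<ᵇ-true (s≤s h<q))) ⟨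
  A₁ + (if suc h <ᵇ 1 + q then X else 0) + S ∎
  where
  open ≡-Reasoning
  X  = descents k h (suc h)
  A₁ = descents↑ k (suc h) (1 + q)
  A₂ = descents↑ k (suc h) (2 + q)
  S  = mulX (suc e) (descentSeries q) k
  h<q : h < q
  h<q = subst (h <_) eq (s≤s (m≤n+m h e))

-- The paths admitted by the larger bound have their first peak at q + 1. Going down j ≤ h steps,
-- then up to that peak and down once takes e + 2 + 2j steps, whence the factor x^(e+2) [h+1]_z.
descents-raise : ∀ k h e q → e + h ≡ q →
  descents k h (2 + q) ≡ descents k h (1 + q) + mulX (2 + e) (qI (suc h) (descentSeries q)) k
descents-raise zero    zero    e q eq = refl
descents-raise zero    (suc h) e q eq = refl
descents-raise (suc k) zero    e q eq =
  trans (descents↑-raise k 0 e q eq)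
        (cong (descents↑ k 0 (1 + q) +_) (sym (mulX-cong (suc e) (mulZ-one (descentSeries q)) k)))
descents-raise (suc k) (suc h) e q eq =
  trans (cong₂ _+_ (descents↑-raise k (suc h) e q eq) (descents-raise k h (suc e) q (trans (sym (+-suc e h)) eq)))
        (+-mulX-qI-suc (descents↑ k (suc h) (1 + q)) (descents k h (1 + q)) (suc e) (suc h) (descentSeries q) k)

descentSeries-suc : ∀ q → descentSeries (suc q) ≗ mulX 1 (qI (2 + q) (descentSeries q))
descentSeries-suc q zero    = refl
descentSeries-suc q (suc k) = begin
  descents↑ k (suc q) (2 + q) + descents k q (2 + q)
    ≡⟨ cong (_+ descents k q (2 + q)) (descents↑-vanish k (suc q) (2 + q) ≤-refl) ⟩
  descents k q (2 + q)
    ≡⟨ descents-raise k q 0 q refl ⟩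
  descentSeries q k + mulX 2 (qI (suc q) (descentSeries q)) k
    ≡⟨ qI-suc (suc q) (descentSeries q) k ⟨
  qI (2 + q) (descentSeries q) k ∎
  where open ≡-Reasoning

descentSeries-qfact : ∀ q → descentSeries q ≗ mulX q (mulZ (qfact (suc q)) δ)
descentSeries-qfact zero    k = begin
  descents k 0 1                  ≡⟨ descents-ground k 1 ≤-refl ⟩
  δ k                             ≡⟨ ≗-trans (mulZ-one _) (mulZ-one δ) k ⟨
  mulZ (qint 1) (mulZ (qfact 0) δ) k ≡⟨ mulZ-⊗ (qint 1) (qfact 0) δ k ⟨
  mulZ (qfact 1) δ k              ∎
  where open ≡-Reasoning
descentSeries-qfact (suc q) = begin
  descentSeries (suc q)                               ≈⟨ descentSeries-suc q ⟩
  mulX 1 (qI (2 + q) (descentSeries q))               ≈⟨ mulX-cong 1 (mulZ-cong (qint (2 + q)) (descentSeries-qfact q)) ⟩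
  mulX 1 (qI (2 + q) (mulX q (mulZ F δ)))             ≈⟨ mulX-cong 1 (mulZ-mulX (qint (2 + q)) q _) ⟩
  mulX 1 (mulX q (qI (2 + q) (mulZ F δ)))             ≈⟨ mulX-+ 1 q _ ⟨
  mulX (suc q) (mulZ (qint (2 + q)) (mulZ F δ))       ≈⟨ mulX-cong (suc q) (mulZ-⊗ (qint (2 + q)) F δ) ⟨
  mulX (suc q) (mulZ (qfact (2 + q)) δ)               ∎
  where
  open SetoidReasoning (ℕ →-setoid ℕ)
  F = qfact (suc q)

-- Unimodal paths by maximal peak

mutual
  unimodals-saturated : ∀ M k h p → M ≤ p → unimodals M k h p ≡ descents k h p
  unimodals-saturated M zero    zero    p _   = refl
  unimodals-saturated M zero    (suc h) p _   = refl
  unimodals-saturated M (suc k) zero    p M≤p = unimodals↑-saturated M k zero p M≤p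
  unimodals-saturated M (suc k) (suc h) p M≤p =
    cong₂ _+_ (unimodals↑-saturated M k (suc h) p M≤p) (unimodals-saturated M k h p M≤p)

  unimodals↑-saturated : ∀ M k h p → M ≤ p → unimodals↑ M k h p ≡ descents↑ k h p
  unimodals↑-saturated M zero    h p _   = refl
  unimodals↑-saturated M (suc k) h p M≤p = cong₂ _+_ (unimodals↑-saturated M k (suc h) p M≤p) peak
    where
    E = if suc h <ᵇ p then descents k h (suc h) else 0
    peak : (if p <ᵇ suc h then (if h <ᵇ M then unimodals M k h (suc h) else 0) else E) ≡ E
    peak with p <ᵇ suc h in p<ᵇ1+h
    ... | false = refl
    ... | true  = let p<1+h = <ᵇ≡true⇒< {p} {suc h} p<ᵇ1+h in
      trans (if-false (<ᵇ-false (≤-trans M≤p (s≤s⁻¹ p<1+h)))) (sym (if-false (<ᵇ-false (<⇒≤ p<1+h))))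

unimodals↑-bound-irrelevant : ∀ M k h p → M < h → unimodals↑ (suc M) k h p ≡ unimodals↑ M k h p
unimodals↑-bound-irrelevant M zero    h p _   = refl
unimodals↑-bound-irrelevant M (suc k) h p M<h =
  cong₂ _+_ (unimodals↑-bound-irrelevant M k (suc h) p (m≤n⇒m≤1+n M<h))
            (cong (λ n → if p <ᵇ suc h then n else (if suc h <ᵇ p then descents k h (suc h) else 0))
                  (trans (if-false (<ᵇ-false M<h)) (sym (if-false (<ᵇ-false (<⇒≤ M<h))))))

-- The paths admitted by the larger bound have maximal peak exactly M + 1, after which they descend
-- from height M with lower peaks.
mutual
  unimodals↑-raise-p≤h : ∀ k h r M p → r + h ≡ M → p ≤ h →
    unimodals↑ (suc M) k h p ≡ unimodals↑ M k h p + mulX (suc r) (qProd (suc h) r (descentSeries M)) k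
  unimodals↑-raise-p≤h zero    h r       M  p _    _   = refl
  unimodals↑-raise-p≤h (suc k) h zero    .h p refl p≤h = begin
    unimodals↑ (suc h) k (suc h) p + (if p <ᵇ suc h then (if h <ᵇ suc h then U else 0) else E)
      ≡⟨ cong₂ _+_ (unimodals↑-bound-irrelevant h k (suc h) p ≤-refl)
                   (trans (if-true (<ᵇ-true (s≤s p≤h)))
                          (trans (if-true (<ᵇ-true {h} ≤-refl)) (unimodals-saturated (suc h) k h (suc h) ≤-refl))) ⟩
    A + descentSeries h k
      ≡⟨ cong (_+ descentSeries h k) (+-identityʳ A) ⟨
    A + 0 + descentSeries h k
      ≡⟨ cong (λ n → A + n + descentSeries h k) (trans (if-true (<ᵇ-true (s≤s p≤h))) (if-false (<ᵇ-false {h} ≤-refl))) ⟨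
    A + (if p <ᵇ suc h then (if h <ᵇ h then unimodals h k h (suc h) else 0) else E) + descentSeries h k ∎
    where
    open ≡-Reasoning
    A = unimodals↑ h k (suc h) p
    U = unimodals (suc h) k h (suc h)
    E = if suc h <ᵇ p then descents k h (suc h) else 0
  unimodals↑-raise-p≤h (suc k) h (suc r) M p eq p≤h = begin
    unimodals↑ (suc M) k (suc h) p + (if p <ᵇ suc h then (if h <ᵇ suc M then unimodals (suc M) k h (suc h) else 0) else E)
      ≡⟨ cong₂ _+_ (unimodals↑-raise-p≤h k (suc h) r M p eq′ (m≤n⇒m≤1+n p≤h))
                   (trans (if-true (<ᵇ-true (s≤s p≤h)))
                          (trans (if-true (<ᵇ-true (m≤n⇒m≤1+n h<M))) (unimodals-raise k h 1 r (suc h) M refl eq′))) ⟩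
    (A + mulX (suc r) X k) + (B + mulX (3 + r) (qI (suc h) X) k)
      ≡⟨ +-mulX-qI-suc A B (suc r) (suc h) X k ⟩
    A + B + mulX (suc r) (qI (2 + h) X) k
      ≡⟨ cong (λ n → A + n + mulX (suc r) (qI (2 + h) X) k) (trans (if-true (<ᵇ-true (s≤s p≤h))) (if-true (<ᵇ-true h<M))) ⟨
    A + (if p <ᵇ suc h then (if h <ᵇ M then B else 0) else E) + mulX (suc r) (qI (2 + h) X) k ∎
    where
    open ≡-Reasoning
    eq′ = trans (+-suc r h) eq
    h<M : h < M
    h<M = subst (h <_) eq (s≤s (m≤n+m h r))
    X = qProd (2 + h) r (descentSeries M)
    A = unimodals↑ M k (suc h) p
    B = unimodals M k h (suc h)
    E = if suc h <ᵇ p then descents k h (suc h) else 0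

  unimodals↑-raise-h≤p : ∀ k h j l p M → j + h ≡ p → l + p ≡ M →
    unimodals↑ (suc M) k h p ≡ unimodals↑ M k h p + mulX (suc (j + l)) (qProd (suc p) l (descentSeries M)) k
  unimodals↑-raise-h≤p k       h zero    l .h M refl eqM = unimodals↑-raise-p≤h k h l M h eqM ≤-refl
  unimodals↑-raise-h≤p zero    h (suc j) l p  M _    _   = refl
  unimodals↑-raise-h≤p (suc k) h (suc j) l p  M eqp  eqM = begin
    unimodals↑ (suc M) k (suc h) p + (if p <ᵇ suc h then (if h <ᵇ suc M then unimodals (suc M) k h (suc h) else 0) else E)
      ≡⟨ cong₂ _+_ (unimodals↑-raise-h≤p k (suc h) j l p M (trans (+-suc j h) eqp) eqM) (if-false (<ᵇ-false h<p)) ⟩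
    A + S + E
      ≡⟨ xy∙z≈xz∙y A S E ⟩
    A + E + S
      ≡⟨ cong (λ n → A + n + S) (if-false (<ᵇ-false h<p)) ⟨
    A + (if p <ᵇ suc h then (if h <ᵇ M then unimodals M k h (suc h) else 0) else E) + S ∎
    where
    open ≡-Reasoning
    h<p : suc h ≤ p
    h<p = subst (suc h ≤_) eqp (s≤s (m≤n+m h j))
    A = unimodals↑ M k (suc h) p
    S = mulX (suc (j + l)) (qProd (suc p) l (descentSeries M)) k
    E = if suc h <ᵇ p then descents k h (suc h) else 0

  unimodals-raise : ∀ k h j l p M → j + h ≡ p → l + p ≡ M →
    unimodals (suc M) k h p ≡ unimodals M k h p + mulX (2 + (j + l)) (qI (suc h) (qProd (suc p) l (descentSeries M))) k
  unimodals-raise zero    zero    j l p M _   _   = refl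
  unimodals-raise zero    (suc h) j l p M _   _   = refl
  unimodals-raise (suc k) zero    j l p M eqp eqM =
    trans (unimodals↑-raise-h≤p k 0 j l p M eqp eqM)
          (cong (unimodals↑ M k 0 p +_) (sym (mulX-cong (suc (j + l)) (mulZ-one _) k)))
  unimodals-raise (suc k) (suc h) j l p M eqp eqM =
    trans (cong₂ _+_ (unimodals↑-raise-h≤p k (suc h) j l p M eqp eqM)
                     (unimodals-raise k h (suc j) l p M (trans (sym (+-suc j h)) eqp) eqM))
          (+-mulX-qI-suc (unimodals↑ M k (suc h) p) (unimodals M k h p) (suc (j + l)) (suc h)
                         (qProd (suc p) l (descentSeries M)) k)

term-zero-series : mulZ (term 0) δ ≗ δ
term-zero-series = ≗-trans (mulZ-⊗ (1 ∷ []) (1 ∷ []) δ) (≗-trans (mulZ-one _) (mulZ-one δ))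

term-series : ∀ M → mulX (2 + M) (qProd 0 (suc M) (descentSeries M)) ≗ mulZ (term (suc M)) δ
term-series M = begin
  mulX (2 + M) (qProd 0 (suc M) (descentSeries M))      ≈⟨ mulX-cong (2 + M) (qProd-qfact (suc M) _) ⟩
  mulX (2 + M) (mulZ F (descentSeries M))               ≈⟨ mulX-cong (2 + M) (mulZ-cong F (descentSeries-qfact M)) ⟩
  mulX (2 + M) (mulZ F (mulX M (mulZ F δ)))             ≈⟨ mulX-cong (2 + M) (mulZ-mulX F M _) ⟩
  mulX (2 + M) (mulX M (mulZ F (mulZ F δ)))             ≈⟨ mulX-+ (2 + M) M _ ⟨
  mulX (2 + M + M) (mulZ F (mulZ F δ))                  ≈⟨ (λ k → cong (λ e → mulX e (mulZ F (mulZ F δ)) k) 2+M+M≡2*[1+M]) ⟩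
  mulX (2 * suc M) (mulZ F (mulZ F δ))                  ≈⟨ mulX-cong (2 * suc M) (mulZ-⊗ F F δ) ⟨
  mulX (2 * suc M) (mulZ (F ⊗ F) δ)                     ≈⟨ mulZ-shift (suc M) (F ⊗ F) δ ⟨
  mulZ (term (suc M)) δ                                 ∎
  where
  open SetoidReasoning (ℕ →-setoid ℕ)
  F = qfact (suc M)
  2+M+M≡2*[1+M] : 2 + M + M ≡ 2 * suc M
  2+M+M≡2*[1+M] = trans (cong (λ m → 2 + (M + m)) (sym (+-identityʳ M))) (sym (*-suc 2 M))

unimodals-series : ∀ M k → unimodals M k 0 0 ≡ sum (applyUpTo (λ a → mulZ (term a) δ k) (suc M))
unimodals-series zero    k =
  trans (unimodals-saturated 0 k 0 0 z≤n)
        (trans (descents-ground k 0 z≤n) (sym (trans (+-identityʳ _) (term-zero-series k))))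
unimodals-series (suc M) k = begin
  unimodals (suc M) k 0 0
    ≡⟨ unimodals-raise k 0 0 M 0 M refl (+-identityʳ M) ⟩
  unimodals M k 0 0 + mulX (2 + M) (qProd 0 (suc M) (descentSeries M)) k
    ≡⟨ cong₂ _+_ (unimodals-series M k) (term-series M k) ⟩
  sum (applyUpTo T (suc M)) + T (suc M)
    ≡⟨ sum-applyUpTo-suc T (suc M) ⟨
  sum (applyUpTo T (suc (suc M))) ∎
  where
  open ≡-Reasoning
  T = λ a → mulZ (term a) δ k

term-vanish : ∀ n a → suc n ≤ a → mulZ (term a) δ (2 * n) ≡ 0
term-vanish n a n<a = trans (mulZ-shift a _ δ (2 * n)) (mulX-low (2 * a) _ (*-monoʳ-< 2 n<a))

mainTheorem16 : (n : ℕ) → countM n ≡ rhsCoeff n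
mainTheorem16 n = begin
  countM n                                    ≡⟨ countM≡unimodals n ⟩
  unimodals (2 * n) (2 * n) 0 0               ≡⟨ unimodals-series (2 * n) (2 * n) ⟩
  sum (applyUpTo T (suc (n + (n + 0))))       ≡⟨ cong (λ m → sum (applyUpTo T (suc (n + m)))) (+-identityʳ n) ⟩
  sum (applyUpTo T (suc n + n))               ≡⟨ sum-applyUpTo-vanishing T (suc n) n (term-vanish n) ⟩
  sum (applyUpTo T (suc n))                   ≡⟨ cong sum (map-upTo T (suc n)) ⟨
  sum (map T (upTo (suc n)))                  ≡⟨ mulZ-foldr-⊕ term δ (2 * n) (upTo (suc n)) ⟨
  mulZ (foldr _⊕_ [] terms) δ (2 * n)         ≡⟨ coeff-mulZ-δ (foldr _⊕_ [] terms) n ⟨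
  rhsCoeff n                                  ∎
  where
  open ≡-Reasoning
  T = λ a → mulZ (term a) δ (2 * n)
  terms = map term (upTo (suc n))
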